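{- Let $G$ be a graph of order $n\geq 4$ with edge-connectivity $\lambda(G)$. Then $\mu_{n-1}(G)=\left\lfloor \frac{\lambda(G)}{n-1}\right\rfloor$.
   Context: For a graph $G$ and $S\subseteq V(G)$ with $|S|\geq 2$, a pendant $S$-Steiner tree is a subgraph of $G$ that is a tree whose vertex set contains $S$ and in which every vertex of $S$ has degree exactly $1$. $\mu_G(S)$ is the maximum number of pairwise edge-disjoint pendant $S$-Steiner trees in $G$, and for $2\leq k\leq |V(G)|$, $\mu_k(G)=\min\{\mu_G(S): S\subseteq V(G),|S|=k\}$. $\lambda(G)$ denotes the (classical) edge-connectivity of $G$ (with $\lambda(G)=0$ if $G$ is disconnected). -}

module Defs where

open import Data.Nat using (ℕ; zero; suc; _≤_; _<_; _∸_; s≤s; z≤n; NonZero; >-nonZero) renaming (_<ᵇ_ to _<ᵇℕ_)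
open import Data.Nat.DivMod using (_/_)
open import Data.Bool using (Bool; true; false; _∧_; _∨_; not)
open import Data.Fin using (Fin; zero; suc; toℕ; inject₁; fromℕ)
open import Data.List using (List; length; filterᵇ; cartesianProduct)
open import Data.List using () renaming (allFin to allFinL)
open import Data.Product using (Σ; _×_; _,_; ∃; proj₁; proj₂)
open import Data.Empty using (⊥)
open import Relation.Binary.PropositionalEquality using (_≡_; _≢_)
open import Function.Definitions using (Injective)

record Graph (n : ℕ) : Set where
  field
    Adj     : Fin n → Fin n → Bool
    sym     : ∀ u v → Adj u v ≡ true → Adj v u ≡ true
    irrefl  : ∀ v → Adj v v ≡ false
open Graph public

data Walk {n : ℕ} (E : Fin n → Fin n → Bool) : Fin n → Fin n → Set where
  here : ∀ {u} → Walk E u u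
  step : ∀ {u w v} → E u w ≡ true → Walk E w v → Walk E u v

edgeCount : ∀ {n} → (Fin n → Fin n → Bool) → ℕ
edgeCount {n} E =
  length (filterᵇ (λ p → (toℕ (proj₁ p) <ᵇℕ toℕ (proj₂ p)) ∧ E (proj₁ p) (proj₂ p))
                  (cartesianProduct (allFinL n) (allFinL n)))

card : ∀ {n} → (Fin n → Bool) → ℕ
card {n} S = length (filterᵇ S (allFinL n))

removeEdges : ∀ {n} → Graph n → (Fin n → Fin n → Bool) → Fin n → Fin n → Bool
removeEdges G F u v = Adj G u v ∧ not (F u v ∨ F v u)

removedCount : ∀ {n} → Graph n → (Fin n → Fin n → Bool) → ℕ
removedCount G F = edgeCount (λ u v → Adj G u v ∧ (F u v ∨ F v u))

DisconnectedAdj : ∀ {n} → (Fin n → Fin n → Bool) → Set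
DisconnectedAdj {n} E = Σ (Fin n) λ u → Σ (Fin n) λ v → (Walk E u v → ⊥)

-- an edge cut: a set of edges whose removal leaves a disconnected graph
-- (the empty set counts when G itself is disconnected, so λ(G) = 0 then)
IsDisconnectingSet : ∀ {n} → Graph n → (Fin n → Fin n → Bool) → Set
IsDisconnectingSet G F = DisconnectedAdj (removeEdges G F)

IsEdgeConnectivity : ∀ {n} → Graph n → ℕ → Set
IsEdgeConnectivity G l =
  (Σ _ λ F → IsDisconnectingSet G F × removedCount G F ≡ l) ×
  (∀ F → IsDisconnectingSet G F → l ≤ removedCount G F)

record Subgraph {n : ℕ} (G : Graph n) : Set where
  field
    V      : Fin n → Bool
    E      : Fin n → Fin n → Bool
    E-sym  : ∀ u v → E u v ≡ true → E v u ≡ true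
    E⊆G    : ∀ u v → E u v ≡ true → Adj G u v ≡ true
    E-ends : ∀ u v → E u v ≡ true → V u ≡ true
open Subgraph public

degree : ∀ {n} {G : Graph n} → Subgraph G → Fin n → ℕ
degree {n} H v = length (filterᵇ (E H v) (allFinL n))

record Cycle {n : ℕ} {G : Graph n} (H : Subgraph G) : Set where
  field
    k       : ℕ
    c       : Fin (suc (suc (suc k))) → Fin n
    c-inj   : Injective _≡_ _≡_ c
    c-step  : ∀ (i : Fin (suc (suc k))) → E H (c (inject₁ i)) (c (suc i)) ≡ true
    c-close : E H (c (fromℕ (suc (suc k)))) (c zero) ≡ true

IsConnectedSub : ∀ {n} {G : Graph n} → Subgraph G → Set
IsConnectedSub {n} H = ∀ (u v : Fin n) → V H u ≡ true → V H v ≡ true → Walk (E H) u v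

IsTree : ∀ {n} {G : Graph n} → Subgraph G → Set
IsTree H = IsConnectedSub H × (Cycle H → ⊥)

IsPendantSteinerTree : ∀ {n} {G : Graph n} → (Fin n → Bool) → Subgraph G → Set
IsPendantSteinerTree {n} S T =
  IsTree T ×
  (∀ (v : Fin n) → S v ≡ true → V T v ≡ true) ×
  (∀ (v : Fin n) → S v ≡ true → degree T v ≡ 1)

EdgeDisjoint : ∀ {n} {G : Graph n} → Subgraph G → Subgraph G → Set
EdgeDisjoint {n} T₁ T₂ = ∀ (u v : Fin n) → E T₁ u v ≡ true → E T₂ u v ≡ true → ⊥

HasPacking : ∀ {n} → (G : Graph n) → (Fin n → Bool) → ℕ → Set
HasPacking G S m =
  Σ (Fin m → Subgraph G) λ T →
    (∀ i → IsPendantSteinerTree S (T i)) ×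
    (∀ i j → i ≢ j → EdgeDisjoint (T i) (T j))

IsMuS : ∀ {n} → Graph n → (Fin n → Bool) → ℕ → Set
IsMuS G S m = HasPacking G S m × (∀ m' → HasPacking G S m' → m' ≤ m)

IsMuK : ∀ {n} → ℕ → Graph n → ℕ → Set
IsMuK {n} k G m =
  (Σ (Fin n → Bool) λ S → card S ≡ k × IsMuS G S m) ×
  (∀ (S : Fin n → Bool) → card S ≡ k → ∀ m' → IsMuS G S m' → m ≤ m')

pred-pos : ∀ {n} → 4 ≤ n → 0 < n ∸ 1
pred-pos (s≤s (s≤s _)) = s≤s z≤n

floorDiv : ∀ (l n : ℕ) → 4 ≤ n → ℕ
floorDiv l n h = _/_ l (n ∸ 1) {{>-nonZero (pred-pos h)}}

-- Write S = V ∖ {w}. Since S has at least three vertices, a pendant S-Steiner tree joins every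
-- vertex of S directly to w: if the unique neighbour z of a leaf y ∈ S were itself in S, the
-- edge yz would be a whole component of the tree, missing a third vertex of S. So the star at w
-- is the only candidate, μ_G(S) ≤ 1 with equality iff w is adjacent to every other vertex, and
-- μ_{n-1}(G) is 1 if G is complete and 0 otherwise. Correspondingly λ(K_n) = n - 1: a cut
-- separating a from b contains aw or wb for every w ≠ a, which are n - 1 distinct edges;
-- and a missing edge uv gives λ(G) ≤ deg u ≤ n - 2.
module Submission where

open import Defs hiding (sym)
open import Data.Bool using (Bool; true; false; _∧_; _∨_; not; _xor_; if_then_else_)
import Data.Bool as Bool
open import Data.Bool.Properties
  using (¬-not; not-injective; ∨-conicalˡ; ∨-conicalʳ; ∧-conicalˡ; ∧-conicalʳ; ∨-inverseʳ; ∧-inverseʳ;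
         ∧-distribˡ-∨; ∧-distribʳ-∨; ∧-assoc; ∧-comm; ∨-comm; ∧-zeroʳ; ∧-identityʳ; ∨-identityʳ;
         xor-comm; xor-same)
open import Data.Empty using (⊥; ⊥-elim)
open import Data.Fin using (Fin; zero; suc; toℕ; _≟_; punchIn)
open import Data.Fin.Properties using (punchInᵢ≢i; any?)
open import Data.List using (List; length; filterᵇ; tabulate; map; _++_; cartesianProduct)
open import Data.List.Properties using (filter-++; length-++; map-tabulate)
open import Data.Nat using (ℕ; zero; suc; _+_; _≤_; _<_; _∸_; s≤s; z≤n; >-nonZero)
  renaming (_<ᵇ_ to _<ᵇℕ_)
open import Data.Nat.DivMod using (m<n⇒m/n≡0; n/n≡1)
open import Data.Nat.Properties
  using (+-mono-≤; +-monoʳ-≤; +-comm; +-identityʳ; ≤-refl; ≤-trans; ≤-reflexive; ≤-antisym; ≤-pred;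
         m≤m+n; 1+n≰n; suc-injective; +-cancelˡ-≡; +-cancelˡ-<; module ≤-Reasoning; +-0-commutativeMonoid)
open import Algebra.Properties.CommutativeMonoid.Sum +-0-commutativeMonoid
  using (sum; sum-cong-≗; sum-remove; sum-replicate-zero; ∑-distrib-+; ∑-comm)
open import Data.Product using (_×_; _,_; ∃; ∃₂; proj₁; proj₂)
open import Data.Sum using (_⊎_; inj₁; inj₂; [_,_]′)
open import Function using (_∘_; id; case_of_)
open import Relation.Nullary using (¬?; yes; no; does; _×-dec_)
open import Relation.Nullary.Decidable using (dec-true; dec-false; T?)
open import Relation.Binary.PropositionalEquality

-- Counting over Fin n

infix 4 _==_

_==_ : ∀ {n} → Fin n → Fin n → Bool
x == y = does (x ≟ y)

==-refl : ∀ {n} (x : Fin n) → (x == x) ≡ true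
==-refl x = dec-true (x ≟ x) refl

==-≢ : ∀ {n} {x y : Fin n} → x ≢ y → (x == y) ≡ false
==-≢ {x = x} {y} = dec-false (x ≟ y)

==⇒≡ : ∀ {n} (x y : Fin n) → (x == y) ≡ true → x ≡ y
==⇒≡ x y eq with x ≟ y
... | yes x≡y = x≡y

==-false⇒≢ : ∀ {n} {x y : Fin n} → (x == y) ≡ false → x ≢ y
==-false⇒≢ {x = x} x≠y refl = case trans (sym (==-refl x)) x≠y of λ ()

sum-mono-≤ : ∀ {n} {f g : Fin n → ℕ} → (∀ i → f i ≤ g i) → sum f ≤ sum g
sum-mono-≤ {zero}  f≤g = z≤n
sum-mono-≤ {suc n} f≤g = +-mono-≤ (f≤g zero) (sum-mono-≤ (f≤g ∘ suc))

sum-zero : ∀ {n} {f : Fin n → ℕ} → (∀ i → f i ≡ 0) → sum f ≡ 0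
sum-zero {n} f≡0 = trans (sum-cong-≗ f≡0) (sum-replicate-zero n)

sum-point : ∀ {n} {f : Fin (suc n) → ℕ} (c : Fin (suc n)) → (∀ i → i ≢ c → f i ≡ 0) → sum f ≡ f c
sum-point {f = f} c f≡0 = begin
  sum f                       ≡⟨ sum-remove {i = c} f ⟩
  f c + sum (f ∘ punchIn c)   ≡⟨ cong (f c +_) (sum-zero (λ j → f≡0 (punchIn c j) (punchInᵢ≢i c j))) ⟩
  f c + 0                     ≡⟨ +-identityʳ (f c) ⟩
  f c                         ∎
  where open ≡-Reasoning

indicator : Bool → ℕ
indicator b = if b then 1 else 0

count : ∀ {n} → (Fin n → Bool) → ℕ
count p = sum (indicator ∘ p)

count-cong : ∀ {n} {p q : Fin n → Bool} → (∀ x → p x ≡ q x) → count p ≡ count q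
count-cong p≗q = sum-cong-≗ (cong indicator ∘ p≗q)

count-mono : ∀ {n} {p q : Fin n → Bool} → (∀ x → p x ≡ true → q x ≡ true) → count p ≤ count q
count-mono p⊆q = sum-mono-≤ λ x → indicator-mono (p⊆q x)
  where
  indicator-mono : ∀ {a b} → (a ≡ true → b ≡ true) → indicator a ≤ indicator b
  indicator-mono {false} _   = z≤n
  indicator-mono {true}  a⇒b rewrite a⇒b refl = ≤-refl

count-const-false : ∀ {n} → count {n} (λ _ → false) ≡ 0
count-const-false {n} = sum-zero {n} (λ _ → refl)

count-const-true : ∀ {n} → count {n} (λ _ → true) ≡ n
count-const-true {zero}  = refl
count-const-true {suc n} = cong suc (count-const-true {n})

count-∨-∧ : ∀ {n} (p q : Fin n → Bool) →
  count (λ x → p x ∨ q x) + count (λ x → p x ∧ q x) ≡ count p + count q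
count-∨-∧ p q = begin
  count (λ x → p x ∨ q x) + count (λ x → p x ∧ q x)
    ≡⟨ ∑-distrib-+ (indicator ∘ (λ x → p x ∨ q x)) (indicator ∘ (λ x → p x ∧ q x)) ⟨
  sum (λ x → indicator (p x ∨ q x) + indicator (p x ∧ q x))
    ≡⟨ sum-cong-≗ (λ x → pointwise (p x) (q x)) ⟩
  sum (λ x → indicator (p x) + indicator (q x))
    ≡⟨ ∑-distrib-+ (indicator ∘ p) (indicator ∘ q) ⟩
  count p + count q ∎
  where
  open ≡-Reasoning
  pointwise : ∀ a b → indicator (a ∨ b) + indicator (a ∧ b) ≡ indicator a + indicator b
  pointwise false b     = +-identityʳ (indicator b)
  pointwise true  false = refl
  pointwise true  true  = refl

count-∨-≤ : ∀ {n} (p q : Fin n → Bool) → count (λ x → p x ∨ q x) ≤ count p + count q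
count-∨-≤ p q = subst (count (λ x → p x ∨ q x) ≤_) (count-∨-∧ p q) (m≤m+n _ _)

count-∨-disjoint : ∀ {n} (p q : Fin n → Bool) → (∀ x → p x ≡ true → q x ≡ true → ⊥) →
  count (λ x → p x ∨ q x) ≡ count p + count q
count-∨-disjoint {n} p q disjoint = begin
  count (λ x → p x ∨ q x)                              ≡⟨ +-identityʳ _ ⟨
  count (λ x → p x ∨ q x) + 0                          ≡⟨ cong (count (λ x → p x ∨ q x) +_) ∧-empty ⟨
  count (λ x → p x ∨ q x) + count (λ x → p x ∧ q x)    ≡⟨ count-∨-∧ p q ⟩
  count p + count q                                    ∎
  where
  open ≡-Reasoning
  ∧-false : ∀ x → (p x ∧ q x) ≡ false
  ∧-false x with p x in px | q x in qx
  ... | false | _     = refl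
  ... | true  | false = refl
  ... | true  | true  = ⊥-elim (disjoint x px qx)
  ∧-empty : count (λ x → p x ∧ q x) ≡ 0
  ∧-empty = trans (count-cong ∧-false) (count-const-false {n})

count-complement : ∀ {n} (p : Fin n → Bool) → count p + count (not ∘ p) ≡ n
count-complement {n} p = begin
  count p + count (not ∘ p)                                        ≡⟨ count-∨-∧ p (not ∘ p) ⟨
  count (λ x → p x ∨ not (p x)) + count (λ x → p x ∧ not (p x))    ≡⟨ cong₂ _+_ (count-cong (∨-inverseʳ ∘ p))
                                                                                  (count-cong (∧-inverseʳ ∘ p)) ⟩
  count {n} (λ _ → true) + count {n} (λ _ → false)                 ≡⟨ cong₂ _+_ (count-const-true {n}) (count-const-false {n}) ⟩
  n + 0                                                            ≡⟨ +-identityʳ n ⟩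
  n                                                                ∎
  where open ≡-Reasoning

count-singleton : ∀ {n} (c : Fin n) → count (_== c) ≡ 1
count-singleton {suc n} c =
  trans (sum-point c (λ x x≢c → cong indicator (==-≢ x≢c))) (cong indicator (==-refl c))

count-pair : ∀ {n} {a b : Fin n} → a ≢ b → count (λ x → (x == a) ∨ (x == b)) ≡ 2
count-pair {n} {a} {b} a≢b =
  trans (count-∨-disjoint {n} (_== a) (_== b) disjoint) (cong₂ _+_ (count-singleton a) (count-singleton b))
  where
  disjoint : ∀ x → (x == a) ≡ true → (x == b) ≡ true → ⊥
  disjoint x x≡a x≡b = a≢b (trans (sym (==⇒≡ x a x≡a)) (==⇒≡ x b x≡b))

count-≥1 : ∀ {n} (p : Fin n → Bool) {a} → p a ≡ true → 1 ≤ count p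
count-≥1 {n} p {a} pa = subst (_≤ count p) (count-singleton a) (count-mono {n} in-p)
  where
  in-p : ∀ x → (x == a) ≡ true → p x ≡ true
  in-p x x≡a = subst (λ y → p y ≡ true) (sym (==⇒≡ x a x≡a)) pa

count-≥2 : ∀ {n} (p : Fin n → Bool) {a b} → a ≢ b → p a ≡ true → p b ≡ true → 2 ≤ count p
count-≥2 {n} p {a} {b} a≢b pa pb = subst (_≤ count p) (count-pair a≢b) (count-mono {n} in-p)
  where
  in-p : ∀ x → ((x == a) ∨ (x == b)) ≡ true → p x ≡ true
  in-p x x∈ab with x ≟ a | x ≟ b
  in-p x _  | yes refl | _        = pa
  in-p x _  | no _     | yes refl = pb
  in-p x () | no _     | no _

count-witness : ∀ {n} (p : Fin n → Bool) → 1 ≤ count p → ∃ λ x → p x ≡ true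
count-witness {suc n} p h with p zero in p0
... | true  = zero , p0
... | false = let x , px = count-witness (p ∘ suc) h in suc x , px

count≡1⇒unique : ∀ {n} (p : Fin n → Bool) → count p ≡ 1 → ∀ {a b} → p a ≡ true → p b ≡ true → a ≡ b
count≡1⇒unique p count≡1 {a} {b} pa pb with a ≟ b
... | yes a≡b = a≡b
... | no  a≢b = ⊥-elim (1+n≰n (subst (2 ≤_) count≡1 (count-≥2 p a≢b pa pb)))

count+falsified≤ : ∀ {n} (p : Fin n → Bool) {k} → k ≤ count (not ∘ p) → count p + k ≤ n
count+falsified≤ p k≤ = subst (count p + _ ≤_) (count-complement p) (+-monoʳ-≤ (count p) k≤)

falsified⇒count<n : ∀ {n} (p : Fin n → Bool) {a} → p a ≡ false → count p < n
falsified⇒count<n {n} p pa =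
  subst (_≤ n) (+-comm (count p) 1) (count+falsified≤ p (count-≥1 (not ∘ p) (cong not pa)))

two-falsified⇒1+count<n : ∀ {n} (p : Fin n → Bool) {a b} → a ≢ b → p a ≡ false → p b ≡ false →
  suc (count p) < n
two-falsified⇒1+count<n {n} p a≢b pa pb =
  subst (_≤ n) (+-comm (count p) 2) (count+falsified≤ p (count-≥2 (not ∘ p) a≢b (cong not pa) (cong not pb)))

count<n⇒falsified : ∀ {n} (p : Fin n → Bool) → count p < n → ∃ λ x → p x ≡ false
count<n⇒falsified {n} p count<n =
  let x , ¬px = count-witness (not ∘ p) (+-cancelˡ-< (count p) 0 _ count+0<count+rest)
  in x , not-injective {y = false} ¬px
  where
  count+0<count+rest : count p + 0 < count p + count (not ∘ p)
  count+0<count+rest = subst₂ _<_ (sym (+-identityʳ (count p))) (sym (count-complement p)) count<n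

vertex-avoiding-three : ∀ {n} → 3 < n → (a b c : Fin n) → ∃ λ t → t ≢ a × t ≢ b × t ≢ c
vertex-avoiding-three {n} 3<n a b c =
  t , ==-false⇒≢ (∨-conicalˡ (t == a) _ t∉abc) , ==-false⇒≢ (∨-conicalˡ (t == b) (t == c) t∉bc)
    , ==-false⇒≢ (∨-conicalʳ (t == b) (t == c) t∉bc)
  where
  in-abc : Fin n → Bool
  in-abc x = (x == a) ∨ ((x == b) ∨ (x == c))
  count≤3 : count in-abc ≤ 3
  count≤3 = ≤-trans (count-∨-≤ (_== a) (λ x → (x == b) ∨ (x == c)))
                    (+-mono-≤ (≤-reflexive (count-singleton a))
                              (≤-trans (count-∨-≤ (_== b) (_== c))
                                       (≤-reflexive (cong₂ _+_ (count-singleton b) (count-singleton c)))))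
  outside : ∃ λ x → in-abc x ≡ false
  outside = count<n⇒falsified in-abc (≤-trans (s≤s count≤3) 3<n)
  t : Fin n
  t = proj₁ outside
  t∉abc : in-abc t ≡ false
  t∉abc = proj₂ outside
  t∉bc : ((t == b) ∨ (t == c)) ≡ false
  t∉bc = ∨-conicalʳ (t == a) _ t∉abc

allBut : ∀ {n} → Fin n → Fin n → Bool
allBut w x = not (x == w)

allBut⇒≢ : ∀ {n} {w x : Fin n} → allBut w x ≡ true → x ≢ w
allBut⇒≢ {x = x} h refl rewrite ==-refl x = case h of λ ()

count-allBut : ∀ {m} (w : Fin (suc m)) → count (allBut w) ≡ m
count-allBut {m} w = suc-injective (begin
  suc (count (allBut w))            ≡⟨ cong (_+ count (allBut w)) (count-singleton w) ⟨
  count (_== w) + count (allBut w)  ≡⟨ count-complement (_== w) ⟩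
  suc m                             ∎)
  where open ≡-Reasoning

length-filterᵇ-tabulate : ∀ {n} {A : Set} (p : A → Bool) (f : Fin n → A) →
  length (filterᵇ p (tabulate f)) ≡ count (p ∘ f)
length-filterᵇ-tabulate {zero}  p f = refl
length-filterᵇ-tabulate {suc n} p f with p (f zero)
... | true  = cong suc (length-filterᵇ-tabulate p (f ∘ suc))
... | false = length-filterᵇ-tabulate p (f ∘ suc)

length-filterᵇ-cartesianProduct : ∀ {m n} {A B : Set} (p : A × B → Bool) (f : Fin m → A) (g : Fin n → B) →
  length (filterᵇ p (cartesianProduct (tabulate f) (tabulate g))) ≡ sum (λ i → count (λ j → p (f i , g j)))
length-filterᵇ-cartesianProduct {zero}  p f g = refl
length-filterᵇ-cartesianProduct {suc m} {A = A} {B} p f g = begin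
  length (filterᵇ p (row ++ rest))                       ≡⟨ cong length (filter-++ (T? ∘ p) row rest) ⟩
  length (filterᵇ p row ++ filterᵇ p rest)               ≡⟨ length-++ (filterᵇ p row) ⟩
  length (filterᵇ p row) + length (filterᵇ p rest)       ≡⟨ cong₂ _+_ row-count rest-count ⟩
  count (λ j → p (f zero , g j)) + sum (λ i → count (λ j → p (f (suc i) , g j))) ∎
  where
  open ≡-Reasoning
  row rest : List (A × B)
  row = map (f zero ,_) (tabulate g)
  rest = cartesianProduct (tabulate (f ∘ suc)) (tabulate g)
  row-count : length (filterᵇ p row) ≡ count (λ j → p (f zero , g j))
  row-count = trans (cong (length ∘ filterᵇ p) (map-tabulate g (f zero ,_)))
                    (length-filterᵇ-tabulate p ((f zero ,_) ∘ g))
  rest-count : length (filterᵇ p rest) ≡ sum (λ i → count (λ j → p (f (suc i) , g j)))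
  rest-count = length-filterᵇ-cartesianProduct p (f ∘ suc) g

card≡count : ∀ {n} (S : Fin n → Bool) → card S ≡ count S
card≡count S = length-filterᵇ-tabulate S id

degree≡count : ∀ {n} {G : Graph n} (H : Subgraph G) v → degree H v ≡ count (E H v)
degree≡count H v = length-filterᵇ-tabulate (E H v) id

-- Counting edges

infix 4 _<ᶠ_

_<ᶠ_ : ∀ {n} → Fin n → Fin n → Bool
x <ᶠ y = toℕ x <ᵇℕ toℕ y

<ᶠ-connex : ∀ {n} (x y : Fin n) → ((x <ᶠ y) ∨ (y <ᶠ x)) ≡ not (x == y)
<ᶠ-connex zero    zero    = refl
<ᶠ-connex zero    (suc y) = refl
<ᶠ-connex (suc x) zero    = refl
<ᶠ-connex (suc x) (suc y) = <ᶠ-connex x y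

<ᶠ-asym : ∀ {n} (x y : Fin n) → (x <ᶠ y) ≡ true → (y <ᶠ x) ≡ true → ⊥
<ᶠ-asym zero    (suc y) _   ()
<ᶠ-asym (suc x) (suc y) x<y y<x = <ᶠ-asym x y x<y y<x

countPairs : ∀ {n} → (Fin n → Fin n → Bool) → ℕ
countPairs P = sum (λ x → count (P x))

countPairs-cong : ∀ {n} {P Q : Fin n → Fin n → Bool} → (∀ x y → P x y ≡ Q x y) → countPairs P ≡ countPairs Q
countPairs-cong P≗Q = sum-cong-≗ (λ x → count-cong (P≗Q x))

countPairs-mono : ∀ {n} {P Q : Fin n → Fin n → Bool} →
  (∀ x y → P x y ≡ true → Q x y ≡ true) → countPairs P ≤ countPairs Q
countPairs-mono P⊆Q = sum-mono-≤ (λ x → count-mono (P⊆Q x))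

countPairs-∨-disjoint : ∀ {n} (P Q : Fin n → Fin n → Bool) → (∀ x y → P x y ≡ true → Q x y ≡ true → ⊥) →
  countPairs (λ x y → P x y ∨ Q x y) ≡ countPairs P + countPairs Q
countPairs-∨-disjoint P Q disjoint =
  trans (sum-cong-≗ (λ x → count-∨-disjoint (P x) (Q x) (disjoint x)))
        (∑-distrib-+ (λ x → count (P x)) (λ x → count (Q x)))

countPairs-transpose : ∀ {n} (P : Fin n → Fin n → Bool) → countPairs P ≡ countPairs (λ y x → P x y)
countPairs-transpose P = ∑-comm (λ x y → indicator (P x y))

countPairs-row : ∀ {n} (c : Fin n) (Q : Fin n → Fin n → Bool) → countPairs (λ x y → (x == c) ∧ Q x y) ≡ count (Q c)
countPairs-row {suc n} c Q =
  trans (sum-point c off-row) (count-cong (λ y → cong (_∧ Q c y) (==-refl c)))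
  where
  off-row : ∀ x → x ≢ c → count (λ y → (x == c) ∧ Q x y) ≡ 0
  off-row x x≢c = trans (count-cong (λ y → cong (_∧ Q x y) (==-≢ x≢c))) (count-const-false {suc n})

edgeCount≡countPairs : ∀ {n} (R : Fin n → Fin n → Bool) → edgeCount R ≡ countPairs (λ x y → (x <ᶠ y) ∧ R x y)
edgeCount≡countPairs {n} R =
  length-filterᵇ-cartesianProduct {n} {n} (λ (x , y) → (x <ᶠ y) ∧ R x y) id id

edgeCount-cong : ∀ {n} {P Q : Fin n → Fin n → Bool} → (∀ x y → P x y ≡ Q x y) → edgeCount P ≡ edgeCount Q
edgeCount-cong {P = P} {Q} P≗Q = begin
  edgeCount P                                ≡⟨ edgeCount≡countPairs P ⟩
  countPairs (λ x y → (x <ᶠ y) ∧ P x y)      ≡⟨ countPairs-cong (λ x y → cong ((x <ᶠ y) ∧_) (P≗Q x y)) ⟩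
  countPairs (λ x y → (x <ᶠ y) ∧ Q x y)      ≡⟨ edgeCount≡countPairs Q ⟨
  edgeCount Q                                ∎
  where open ≡-Reasoning

edgeCount-mono : ∀ {n} {P Q : Fin n → Fin n → Bool} → (∀ x y → P x y ≡ true → Q x y ≡ true) →
  edgeCount P ≤ edgeCount Q
edgeCount-mono {P = P} {Q} P⊆Q =
  subst₂ _≤_ (sym (edgeCount≡countPairs P)) (sym (edgeCount≡countPairs Q)) (countPairs-mono restrict)
  where
  restrict : ∀ x y → ((x <ᶠ y) ∧ P x y) ≡ true → ((x <ᶠ y) ∧ Q x y) ≡ true
  restrict x y h with x <ᶠ y
  ... | true = P⊆Q x y h

edgeCount-∨-disjoint : ∀ {n} (P Q : Fin n → Fin n → Bool) → (∀ x y → P x y ≡ true → Q x y ≡ true → ⊥) →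
  edgeCount (λ x y → P x y ∨ Q x y) ≡ edgeCount P + edgeCount Q
edgeCount-∨-disjoint P Q disjoint = begin
  edgeCount (λ x y → P x y ∨ Q x y)
    ≡⟨ edgeCount≡countPairs (λ x y → P x y ∨ Q x y) ⟩
  countPairs (λ x y → (x <ᶠ y) ∧ (P x y ∨ Q x y))
    ≡⟨ countPairs-cong (λ x y → ∧-distribˡ-∨ (x <ᶠ y) (P x y) (Q x y)) ⟩
  countPairs (λ x y → ((x <ᶠ y) ∧ P x y) ∨ ((x <ᶠ y) ∧ Q x y))
    ≡⟨ countPairs-∨-disjoint (λ x y → (x <ᶠ y) ∧ P x y) (λ x y → (x <ᶠ y) ∧ Q x y) restrict ⟩
  countPairs (λ x y → (x <ᶠ y) ∧ P x y) + countPairs (λ x y → (x <ᶠ y) ∧ Q x y)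
    ≡⟨ cong₂ _+_ (edgeCount≡countPairs P) (edgeCount≡countPairs Q) ⟨
  edgeCount P + edgeCount Q ∎
  where
  open ≡-Reasoning
  restrict : ∀ x y → ((x <ᶠ y) ∧ P x y) ≡ true → ((x <ᶠ y) ∧ Q x y) ≡ true → ⊥
  restrict x y h h′ with x <ᶠ y
  ... | true = disjoint x y h h′

∧-left-comm : ∀ a b c → (a ∧ (b ∧ c)) ≡ (b ∧ (a ∧ c))
∧-left-comm a b c = trans (sym (∧-assoc a b c)) (trans (cong (_∧ c) (∧-comm a b)) (∧-assoc b a c))

star : ∀ {n} → Fin n → (Fin n → Bool) → Fin n → Fin n → Bool
star c g x y = ((x == c) ∧ g y) ∨ ((y == c) ∧ g x)

star-cases : ∀ {n} (c : Fin n) g x y → star c g x y ≡ true → (x ≡ c × g y ≡ true) ⊎ (y ≡ c × g x ≡ true)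
star-cases c g x y h with (x == c) ∧ g y in out
... | true  = inj₁ (==⇒≡ x c (∧-conicalˡ _ _ out) , ∧-conicalʳ _ _ out)
... | false = inj₂ (==⇒≡ y c (∧-conicalˡ _ _ h) , ∧-conicalʳ _ _ h)

edgeCount-row : ∀ {n} (c : Fin n) (g : Fin n → Bool) →
  edgeCount (λ x y → (x == c) ∧ g y) ≡ count (λ y → (c <ᶠ y) ∧ g y)
edgeCount-row c g = begin
  edgeCount (λ x y → (x == c) ∧ g y)
    ≡⟨ edgeCount≡countPairs (λ x y → (x == c) ∧ g y) ⟩
  countPairs (λ x y → (x <ᶠ y) ∧ ((x == c) ∧ g y))
    ≡⟨ countPairs-cong (λ x y → ∧-left-comm (x <ᶠ y) (x == c) (g y)) ⟩
  countPairs (λ x y → (x == c) ∧ ((x <ᶠ y) ∧ g y))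
    ≡⟨ countPairs-row c (λ x y → (x <ᶠ y) ∧ g y) ⟩
  count (λ y → (c <ᶠ y) ∧ g y) ∎
  where open ≡-Reasoning

edgeCount-column : ∀ {n} (c : Fin n) (g : Fin n → Bool) →
  edgeCount (λ x y → (y == c) ∧ g x) ≡ count (λ x → (x <ᶠ c) ∧ g x)
edgeCount-column c g = begin
  edgeCount (λ x y → (y == c) ∧ g x)
    ≡⟨ edgeCount≡countPairs (λ x y → (y == c) ∧ g x) ⟩
  countPairs (λ x y → (x <ᶠ y) ∧ ((y == c) ∧ g x))
    ≡⟨ countPairs-transpose (λ x y → (x <ᶠ y) ∧ ((y == c) ∧ g x)) ⟩
  countPairs (λ y x → (x <ᶠ y) ∧ ((y == c) ∧ g x))
    ≡⟨ countPairs-cong (λ y x → ∧-left-comm (x <ᶠ y) (y == c) (g x)) ⟩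
  countPairs (λ y x → (y == c) ∧ ((x <ᶠ y) ∧ g x))
    ≡⟨ countPairs-row c (λ y x → (x <ᶠ y) ∧ g x) ⟩
  count (λ x → (x <ᶠ c) ∧ g x) ∎
  where open ≡-Reasoning

edgeCount-star : ∀ {n} (c : Fin n) (g : Fin n → Bool) → g c ≡ false → edgeCount (star c g) ≡ count g
edgeCount-star c g gc≡false = begin
  edgeCount (star c g)
    ≡⟨ edgeCount-∨-disjoint (λ x y → (x == c) ∧ g y) (λ x y → (y == c) ∧ g x) not-both ⟩
  edgeCount (λ x y → (x == c) ∧ g y) + edgeCount (λ x y → (y == c) ∧ g x)
    ≡⟨ cong₂ _+_ (edgeCount-row c g) (edgeCount-column c g) ⟩
  count (λ y → (c <ᶠ y) ∧ g y) + count (λ y → (y <ᶠ c) ∧ g y)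
    ≡⟨ count-∨-disjoint (λ y → (c <ᶠ y) ∧ g y) (λ y → (y <ᶠ c) ∧ g y) (λ y h h′ →
         <ᶠ-asym c y (∧-conicalˡ _ _ h) (∧-conicalˡ _ _ h′)) ⟨
  count (λ y → ((c <ᶠ y) ∧ g y) ∨ ((y <ᶠ c) ∧ g y))
    ≡⟨ count-cong (λ y → sym (∧-distribʳ-∨ (g y) (c <ᶠ y) (y <ᶠ c))) ⟩
  count (λ y → ((c <ᶠ y) ∨ (y <ᶠ c)) ∧ g y)
    ≡⟨ count-cong (λ y → trans (cong (_∧ g y) (<ᶠ-connex c y)) (g-off-centre y)) ⟩
  count g ∎
  where
  open ≡-Reasoning
  not-both : ∀ x y → ((x == c) ∧ g y) ≡ true → ((y == c) ∧ g x) ≡ true → ⊥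
  not-both x y h h′ with x ≟ c | y ≟ c
  not-both x y h h′ | yes refl | yes refl with () ← trans (sym gc≡false) (∧-conicalʳ _ _ h)
  not-both x y () h′ | no _ | _
  not-both x y h () | yes _ | no _
  g-off-centre : ∀ y → (not (c == y) ∧ g y) ≡ g y
  g-off-centre y with c ≟ y
  ... | yes refl = sym gc≡false
  ... | no _     = refl

edgeCount-two-stars : ∀ {n} {a b : Fin n} (g h : Fin n → Bool) → g a ≡ false → h a ≡ false → h b ≡ false →
  (∀ w → g w ≡ true → h w ≡ true → ⊥) → edgeCount (λ x y → star a g x y ∨ star b h x y) ≡ count g + count h
edgeCount-two-stars {a = a} {b} g h ga ha hb g∩h = begin
  edgeCount (λ x y → star a g x y ∨ star b h x y)   ≡⟨ edgeCount-∨-disjoint (star a g) (star b h) disjoint ⟩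
  edgeCount (star a g) + edgeCount (star b h)       ≡⟨ cong₂ _+_ (edgeCount-star a g ga) (edgeCount-star b h hb) ⟩
  count g + count h                                 ∎
  where
  open ≡-Reasoning
  disjoint : ∀ x y → star a g x y ≡ true → star b h x y ≡ true → ⊥
  disjoint x y in-g in-h with star-cases a g x y in-g | star-cases b h x y in-h
  ... | inj₁ (_ , gy)    | inj₁ (_ , hy)    = g∩h y gy hy
  ... | inj₁ (refl , _)  | inj₂ (_ , ha′)   = case trans (sym ha) ha′ of λ ()
  ... | inj₂ (refl , _)  | inj₁ (_ , ha′)   = case trans (sym ha) ha′ of λ ()
  ... | inj₂ (_ , gx)    | inj₂ (_ , hx)    = g∩h x gx hx

-- The edges a – w with R a w, together with the edges b – w for the remaining w ≢ a,
-- are count (allBut a) distinct edges of R.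
allBut≤edgeCount : ∀ {n} (R : Fin n → Fin n → Bool) → (∀ x y → R x y ≡ true → R y x ≡ true) →
  ∀ {a b} → R a b ≡ true → (∀ w → w ≢ a → w ≢ b → R a w ≡ true ⊎ R b w ≡ true) →
  count (allBut a) ≤ edgeCount R
allBut≤edgeCount {n} R R-sym {a} {b} Rab cover = begin
  count (allBut a)                                       ≤⟨ count-mono covered ⟩
  count (λ w → g w ∨ h w)                                ≤⟨ count-∨-≤ g h ⟩
  count g + count h                                      ≡⟨ edgeCount-two-stars g h ga ha hb g∩h ⟨
  edgeCount (λ x y → star a g x y ∨ star b h x y)        ≤⟨ edgeCount-mono inside ⟩
  edgeCount R                                            ∎
  where
  open ≤-Reasoning
  g h : Fin n → Bool
  g w = allBut a w ∧ R a w
  h w = allBut b w ∧ (allBut a w ∧ not (R a w))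
  ga : g a ≡ false
  ga rewrite ==-refl a = refl
  hb : h b ≡ false
  hb rewrite ==-refl b = refl
  ha : h a ≡ false
  ha rewrite ==-refl a = ∧-zeroʳ (allBut b a)
  g⇒R : ∀ {w} → g w ≡ true → R a w ≡ true
  g⇒R {w} = ∧-conicalʳ (allBut a w) (R a w)
  h⇒¬R : ∀ {w} → h w ≡ true → not (R a w) ≡ true
  h⇒¬R {w} hw = ∧-conicalʳ (allBut a w) (not (R a w)) (∧-conicalʳ (allBut b w) _ hw)
  h⇒R : ∀ {w} → h w ≡ true → R b w ≡ true
  h⇒R {w} hw with cover w (allBut⇒≢ (∧-conicalˡ (allBut a w) _ (∧-conicalʳ (allBut b w) _ hw)))
                          (allBut⇒≢ (∧-conicalˡ (allBut b w) _ hw))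
  ... | inj₂ Rbw = Rbw
  ... | inj₁ Raw = case trans (sym (cong not Raw)) (h⇒¬R hw) of λ ()
  g∩h : ∀ w → g w ≡ true → h w ≡ true → ⊥
  g∩h w gw hw = case trans (sym (cong not (g⇒R gw))) (h⇒¬R hw) of λ ()
  covered : ∀ w → allBut a w ≡ true → (g w ∨ h w) ≡ true
  covered w w≢a with R a w in Raw | w ≟ b
  ... | true  | _        rewrite w≢a = refl
  ... | false | yes refl with () ← trans (sym Rab) Raw
  ... | false | no _     rewrite w≢a = refl
  inside : ∀ x y → (star a g x y ∨ star b h x y) ≡ true → R x y ≡ true
  inside x y in-gh with star a g x y in in-g | star b h x y in in-h
  ... | true  | _ with star-cases a g x y in-g
  ...   | inj₁ (refl , gy) = g⇒R gy
  ...   | inj₂ (refl , gx) = R-sym a x (g⇒R gx)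
  inside x y in-gh | false | true with star-cases b h x y in-h
  ...   | inj₁ (refl , hy) = h⇒R hy
  ...   | inj₂ (refl , hx) = R-sym b x (h⇒R hx)

-- Edge-connectivity

Adj-sym : ∀ {n} (G : Graph n) u v → Adj G u v ≡ Adj G v u
Adj-sym G u v with Adj G u v in uv | Adj G v u in vu
... | true  | true  = refl
... | false | false = refl
... | true  | false = trans (sym (Graph.sym G u v uv)) vu
... | false | true  = trans (sym uv) (Graph.sym G v u vu)

isolate : ∀ {n} → Fin n → Fin n → Fin n → Bool
isolate u x y = x == u

isolate-disconnects : ∀ {n} (G : Graph n) {u v} → u ≢ v → IsDisconnectingSet G (isolate u)
isolate-disconnects G {u} {v} u≢v = u , v , no-walk
  where
  no-walk : Walk (removeEdges G (isolate u)) u v → ⊥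
  no-walk here = u≢v refl
  no-walk (step {w = w} e _) rewrite ==-refl u | ∧-zeroʳ (Adj G u w) = case e of λ ()

removedCount-isolate : ∀ {n} (G : Graph n) u → removedCount G (isolate u) ≡ count (Adj G u)
removedCount-isolate G u = trans (edgeCount-cong edges-at-u) (edgeCount-star u (Adj G u) (irrefl G u))
  where
  edges-at-u : ∀ x y → (Adj G x y ∧ ((x == u) ∨ (y == u))) ≡ star u (Adj G u) x y
  edges-at-u x y with x ≟ u | y ≟ u
  ... | yes refl | yes refl rewrite irrefl G x = refl
  ... | yes refl | no _     = trans (∧-identityʳ _) (sym (∨-identityʳ _))
  ... | no _     | yes refl = trans (∧-identityʳ _) (Adj-sym G x y)
  ... | no _     | no _     = ∧-zeroʳ _

edgeConnectivity≤degree : ∀ {n} {G : Graph n} {l} → IsEdgeConnectivity G l →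
  ∀ {u v} → u ≢ v → l ≤ count (Adj G u)
edgeConnectivity≤degree {G = G} (_ , minimal) {u} u≢v =
  subst (_ ≤_) (removedCount-isolate G u) (minimal (isolate u) (isolate-disconnects G u≢v))

Complete : ∀ {n} → Graph n → Set
Complete {n} G = ∀ (u v : Fin n) → u ≢ v → Adj G u v ≡ true

removed : ∀ {n} → Graph n → (Fin n → Fin n → Bool) → Fin n → Fin n → Bool
removed G F x y = Adj G x y ∧ (F x y ∨ F y x)

removed-sym : ∀ {n} (G : Graph n) F x y → removed G F x y ≡ true → removed G F y x ≡ true
removed-sym G F x y = trans (sym (cong₂ _∧_ (Adj-sym G x y) (∨-comm (F x y) (F y x))))

kept-if-not-removed : ∀ {n} {G : Graph n} → Complete G → ∀ F x y → x ≢ y →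
  removed G F x y ≡ false → removeEdges G F x y ≡ true
kept-if-not-removed K F x y x≢y not-removed rewrite K x y x≢y = cong not not-removed

complete-cut-paths : ∀ {n} {G : Graph n} → Complete G → ∀ F {a b} → (Walk (removeEdges G F) a b → ⊥) →
  removed G F a b ≡ true × (∀ w → w ≢ a → w ≢ b → removed G F a w ≡ true ⊎ removed G F b w ≡ true)
complete-cut-paths {G = G} K F {a} {b} no-walk = direct , via
  where
  a≢b : a ≢ b
  a≢b refl = no-walk here
  direct : removed G F a b ≡ true
  direct with removed G F a b in ab
  ... | true  = refl
  ... | false = ⊥-elim (no-walk (step (kept-if-not-removed {G = G} K F a b a≢b ab) here))
  via : ∀ w → w ≢ a → w ≢ b → removed G F a w ≡ true ⊎ removed G F b w ≡ true
  via w w≢a w≢b with removed G F a w in aw | removed G F b w in bw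
  ... | true  | _     = inj₁ refl
  ... | false | true  = inj₂ refl
  ... | false | false = ⊥-elim (no-walk (step (kept-if-not-removed {G = G} K F a w (w≢a ∘ sym) aw)
                                           (step (kept-if-not-removed {G = G} K F w b w≢b wb) here)))
    where
    wb : removed G F w b ≡ false
    wb with removed G F w b in wb′
    ... | false = refl
    ... | true  = trans (sym (removed-sym G F w b wb′)) bw

complete-cut-size : ∀ {m} {G : Graph (suc m)} → Complete G → ∀ {F} → IsDisconnectingSet G F →
  m ≤ removedCount G F
complete-cut-size {G = G} K {F} (a , b , no-walk) =
  let direct , via = complete-cut-paths {G = G} K F no-walk in
  subst (_≤ removedCount G F) (count-allBut a) (allBut≤edgeCount (removed G F) (removed-sym G F) direct via)

edgeConnectivity-complete : ∀ {m} {G : Graph (suc m)} {l} → Complete G → IsEdgeConnectivity G l → l ≡ m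
edgeConnectivity-complete {G = G} K λ≡l@((F , (a , b , no-walk) , F≡l) , _) =
  ≤-antisym (≤-pred (≤-trans (s≤s (edgeConnectivity≤degree {G = G} λ≡l a≢b))
                             (falsified⇒count<n (Adj G a) (irrefl G a))))
            (subst (_ ≤_) F≡l (complete-cut-size {G = G} K {F} (a , b , no-walk)))
  where
  a≢b : a ≢ b
  a≢b refl = no-walk here

edgeConnectivity-missing-edge : ∀ {m} {G : Graph (suc m)} {l} {u v} → u ≢ v → Adj G u v ≡ false →
  IsEdgeConnectivity G l → l < m
edgeConnectivity-missing-edge {G = G} {u = u} u≢v uv λ≡l =
  ≤-pred (≤-trans (s≤s (s≤s (edgeConnectivity≤degree {G = G} λ≡l u≢v)))
                  (two-falsified⇒1+count<n (Adj G u) u≢v (irrefl G u) uv))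

-- Pendant Steiner trees for a vertex set missing a single vertex

IsAllBut : ∀ {n} → (Fin n → Bool) → Fin n → Set
IsAllBut {n} S w = S w ≡ false × (∀ (v : Fin n) → v ≢ w → S v ≡ true)

allBut-isAllBut : ∀ {n} (w : Fin n) → IsAllBut (allBut w) w
allBut-isAllBut w = cong not (==-refl w) , λ v v≢w → cong not (==-≢ v≢w)

card-allBut : ∀ {m} (w : Fin (suc m)) → card (allBut w) ≡ m
card-allBut w = trans (card≡count (allBut w)) (count-allBut w)

card≡pred⇒isAllBut : ∀ {m} (S : Fin (suc m) → Bool) → card S ≡ m → ∃ λ w → IsAllBut S w
card≡pred⇒isAllBut {m} S card≡m = w , not-injective {y = false} ¬Sw , others
  where
  one-missing : count (not ∘ S) ≡ 1
  one-missing = +-cancelˡ-≡ m _ 1 (begin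
    m + count (not ∘ S)             ≡⟨ cong (_+ count (not ∘ S)) (trans (sym card≡m) (card≡count S)) ⟩
    count S + count (not ∘ S)       ≡⟨ count-complement S ⟩
    suc m                           ≡⟨ +-comm 1 m ⟩
    m + 1                           ∎)
    where open ≡-Reasoning
  missing : ∃ λ w → not (S w) ≡ true
  missing = count-witness (not ∘ S) (≤-reflexive (sym one-missing))
  w : Fin (suc m)
  w = proj₁ missing
  ¬Sw : not (S w) ≡ true
  ¬Sw = proj₂ missing
  others : ∀ v → v ≢ w → S v ≡ true
  others v v≢w with S v in Sv
  ... | true  = refl
  ... | false = ⊥-elim (v≢w (count≡1⇒unique (not ∘ S) one-missing (cong not Sv) ¬Sw))

walk-closed : ∀ {n} {E : Fin n → Fin n → Bool} (P : Fin n → Set) → (∀ {u v} → P u → E u v ≡ true → P v) →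
  ∀ {a b} → P a → Walk E a b → P b
walk-closed P closed Pa here          = Pa
walk-closed P closed Pa (step e walk) = walk-closed P closed (closed Pa e) walk

module _ {n} {G : Graph n} (T : Subgraph G) {v : Fin n} (leaf : degree T v ≡ 1) where

  leaf-neighbour : ∃ λ z → E T v z ≡ true
  leaf-neighbour = count-witness (E T v) (≤-reflexive (sym (trans (sym (degree≡count T v)) leaf)))

  leaf-neighbour-unique : ∀ {a b} → E T v a ≡ true → E T v b ≡ true → a ≡ b
  leaf-neighbour-unique = count≡1⇒unique (E T v) (trans (sym (degree≡count T v)) leaf)

-- If the neighbour z of y were in S, then {y, z} would be closed under the edges of T,
-- cutting y off from a third vertex t of S.
pendant-attached : ∀ {n} {G : Graph n} {S w} → 4 ≤ n → IsAllBut S w → ∀ {T : Subgraph G} →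
  IsPendantSteinerTree S T → ∀ {y} → S y ≡ true → E T y w ≡ true
pendant-attached {w = w} 4≤n (_ , S-others) {T} ((connected , _) , S⊆V , leaves) {y} Sy
  with leaf-neighbour T (leaves y Sy)
... | z , yz with z ≟ w
...   | yes refl = yz
...   | no z≢w with vertex-avoiding-three 4≤n w y z
...     | t , t≢w , t≢y , t≢z =
  ⊥-elim ([ t≢y , t≢z ]′ (walk-closed (λ x → x ≡ y ⊎ x ≡ z) closed (inj₁ refl)
                                       (connected y t (S⊆V y Sy) (S⊆V t (S-others t t≢w)))))
  where
  closed : ∀ {a b} → a ≡ y ⊎ a ≡ z → E T a b ≡ true → b ≡ y ⊎ b ≡ z
  closed (inj₁ refl) ab = inj₂ (leaf-neighbour-unique T (leaves y Sy) ab yz)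
  closed (inj₂ refl) ab = inj₁ (leaf-neighbour-unique T (leaves z (S-others z z≢w)) ab (E-sym T y z yz))

packing-≤1 : ∀ {n} {G : Graph n} {S w} → 4 ≤ n → IsAllBut S w → ∀ {m} → HasPacking G S m → m ≤ 1
packing-≤1 4≤n S≡V∖w {zero}     _ = z≤n
packing-≤1 4≤n S≡V∖w {suc zero} _ = s≤s z≤n
packing-≤1 {w = w} 4≤n S≡V∖w {suc (suc m)} (T , pendant , disjoint)
  with y , y≢w , _ ← vertex-avoiding-three 4≤n w w w =
  ⊥-elim (disjoint zero (suc zero) (λ ()) y w (attached zero) (attached (suc zero)))
  where
  attached : ∀ i → E (T i) y w ≡ true
  attached i = pendant-attached 4≤n S≡V∖w (pendant i) (proj₂ S≡V∖w y y≢w)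

no-packing-if-nonadjacent : ∀ {n} {G : Graph n} {S w} → 4 ≤ n → IsAllBut S w →
  ∀ {y} → y ≢ w → Adj G y w ≡ false → ∀ {m} → HasPacking G S m → m ≤ 0
no-packing-if-nonadjacent 4≤n S≡V∖w y≢w yw {zero} _ = z≤n
no-packing-if-nonadjacent {w = w} 4≤n S≡V∖w {y} y≢w yw {suc m} (T , pendant , _) =
  case trans (sym (E⊆G (T zero) y w attached)) yw of λ ()
  where
  attached : E (T zero) y w ≡ true
  attached = pendant-attached 4≤n S≡V∖w (pendant zero) (proj₂ S≡V∖w y y≢w)

centred-middle : ∀ {n} {G : Graph n} (H : Subgraph G) {w : Fin n} → (∀ u v → E H u v ≡ true → u ≡ w ⊎ v ≡ w) →
  ∀ {x y z} → x ≢ z → E H x y ≡ true → E H y z ≡ true → y ≡ w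
centred-middle H centred {x} {y} {z} x≢z xy yz with centred x y xy | centred y z yz
... | inj₂ y≡w | _        = y≡w
... | inj₁ _   | inj₁ y≡w = y≡w
... | inj₁ x≡w | inj₂ z≡w = ⊥-elim (x≢z (trans x≡w (sym z≡w)))

-- Both c₀ (between the last vertex and c₁) and c₁ (between c₀ and c₂) would have to be the centre.
centred-acyclic : ∀ {n} {G : Graph n} (H : Subgraph G) {w : Fin n} →
  (∀ u v → E H u v ≡ true → u ≡ w ⊎ v ≡ w) → Cycle H → ⊥
centred-acyclic H {w} centred record { c = c ; c-inj = c-inj ; c-step = c-step ; c-close = c-close } =
  case c-inj (trans c₀≡w (sym c₁≡w)) of λ ()
  where
  c₀≡w : c zero ≡ w
  c₀≡w = centred-middle H centred (λ eq → case c-inj eq of λ ()) c-close (c-step zero)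
  c₁≡w : c (suc zero) ≡ w
  c₁≡w = centred-middle H centred (λ eq → case c-inj eq of λ ()) (c-step zero) (c-step (suc zero))

module _ {n} {G : Graph n} (w : Fin n) (w-dominating : ∀ v → v ≢ w → Adj G w v ≡ true) where

  spoke : Fin n → Fin n → Bool
  spoke u v = (u == w) xor (v == w)

  spoke⊆Adj : ∀ u v → spoke u v ≡ true → Adj G u v ≡ true
  spoke⊆Adj u v uv with u ≟ w
  ... | yes refl = w-dominating v (allBut⇒≢ uv)
  ... | no u≢w with refl ← ==⇒≡ v w uv = Graph.sym G w u (w-dominating u u≢w)

  spoke-centred : ∀ u v → spoke u v ≡ true → u ≡ w ⊎ v ≡ w
  spoke-centred u v uv with u ≟ w
  ... | yes u≡w = inj₁ u≡w
  ... | no _    = inj₂ (==⇒≡ v w uv)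

  spoke-to-centre : ∀ {u} → u ≢ w → spoke u w ≡ true
  spoke-to-centre u≢w rewrite ==-≢ u≢w | ==-refl w = refl

  starTree : Subgraph G
  starTree = record
    { V      = λ _ → true
    ; E      = spoke
    ; E-sym  = λ u v → trans (xor-comm (v == w) (u == w))
    ; E⊆G    = spoke⊆Adj
    ; E-ends = λ _ _ _ → refl
    }

  starTree-connected : IsConnectedSub starTree
  starTree-connected u v _ _ = to-centre u (from-centre v)
    where
    to-centre : ∀ u → Walk spoke w v → Walk spoke u v
    to-centre u walk with u ≟ w
    ... | yes refl = walk
    ... | no u≢w   = step (spoke-to-centre u≢w) walk
    from-centre : ∀ v → Walk spoke w v
    from-centre v with v ≟ w
    ... | yes refl = here
    ... | no v≢w   = step (E-sym starTree v w (spoke-to-centre v≢w)) here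

  starTree-pendant : ∀ {S} → S w ≡ false → IsPendantSteinerTree S starTree
  starTree-pendant {S} Sw =
    (starTree-connected , centred-acyclic starTree spoke-centred) , (λ _ _ → refl) , leaf
    where
    leaf : ∀ v → S v ≡ true → degree starTree v ≡ 1
    leaf v Sv = begin
      degree starTree v                       ≡⟨ degree≡count starTree v ⟩
      count (λ u → (v == w) xor (u == w))     ≡⟨ count-cong (λ u → cong (_xor (u == w)) (==-≢ v≢w)) ⟩
      count (_== w)                           ≡⟨ count-singleton w ⟩
      1                                       ∎
      where
      open ≡-Reasoning
      v≢w : v ≢ w
      v≢w refl = case trans (sym Sw) Sv of λ ()

single-packing : ∀ {n} {G : Graph n} {S T} → IsPendantSteinerTree S T → HasPacking G S 1
single-packing {T = T} pendant = (λ _ → T) , (λ _ → pendant) , λ { zero zero 0≢0 → ⊥-elim (0≢0 refl) }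

isMuS-dominating : ∀ {n} {G : Graph n} {S w} → 4 ≤ n → IsAllBut S w → (∀ v → v ≢ w → Adj G w v ≡ true) →
  IsMuS G S 1
isMuS-dominating {w = w} 4≤n S≡V∖w@(Sw , _) w-dominating =
  single-packing (starTree-pendant w w-dominating Sw) , λ _ → packing-≤1 4≤n S≡V∖w

isMuS-missing-edge : ∀ {n} {G : Graph n} {S w} → 4 ≤ n → IsAllBut S w →
  ∀ {y} → y ≢ w → Adj G y w ≡ false → IsMuS G S 0
isMuS-missing-edge 4≤n S≡V∖w y≢w yw =
  ((λ ()) , (λ ()) , (λ ())) , λ _ → no-packing-if-nonadjacent 4≤n S≡V∖w y≢w yw

isMuK-complete : ∀ {m} {G : Graph (suc m)} → 4 ≤ suc m → Complete G → IsMuK m G 1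
isMuK-complete {G = G} 4≤n K =
  (allBut zero , card-allBut zero , isMuS-dominating 4≤n (allBut-isAllBut zero) (dominating zero)) ,
  λ S card≡m _ μ≡m′ → let w , Sw , _ = card≡pred⇒isAllBut S card≡m in
                      proj₂ μ≡m′ 1 (single-packing (starTree-pendant w (dominating w) Sw))
  where
  dominating : ∀ w v → v ≢ w → Adj G w v ≡ true
  dominating w v v≢w = K w v (v≢w ∘ sym)

isMuK-missing-edge : ∀ {m} {G : Graph (suc m)} → 4 ≤ suc m → ∀ {u v} → u ≢ v → Adj G u v ≡ false →
  IsMuK m G 0
isMuK-missing-edge 4≤n {u} {v} u≢v uv =
  (allBut v , card-allBut v , isMuS-missing-edge 4≤n (allBut-isAllBut v) u≢v uv) , λ _ _ _ _ → z≤n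

complete-or-missing-edge : ∀ {n} (G : Graph n) → Complete G ⊎ ∃₂ λ u v → u ≢ v × Adj G u v ≡ false
complete-or-missing-edge G with any? (λ u → any? (λ v → ¬? (u ≟ v) ×-dec (Adj G u v Bool.≟ false)))
... | yes (u , v , u≢v , uv) = inj₂ (u , v , u≢v , uv)
... | no none                = inj₁ λ u v u≢v → ¬-not (λ uv → none (u , v , u≢v , uv))

floorDiv-≡1 : ∀ {m l} (h : 4 ≤ suc m) → l ≡ m → floorDiv l (suc m) h ≡ 1
floorDiv-≡1 {m} h refl = n/n≡1 m {{>-nonZero (pred-pos h)}}

floorDiv-≡0 : ∀ {m l} (h : 4 ≤ suc m) → l < m → floorDiv l (suc m) h ≡ 0
floorDiv-≡0 h l<m = m<n⇒m/n≡0 {{>-nonZero (pred-pos h)}} l<m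

proposition2p5 : ∀ (n : ℕ) (h : 4 ≤ n) (G : Graph n) (l : ℕ) →
    IsEdgeConnectivity G l → IsMuK (n ∸ 1) G (floorDiv l n h)
proposition2p5 (suc m) 4≤n G l λ≡l with complete-or-missing-edge G
... | inj₁ K =
  subst (IsMuK m G) (sym (floorDiv-≡1 4≤n (edgeConnectivity-complete {G = G} K λ≡l)))
        (isMuK-complete {G = G} 4≤n K)
... | inj₂ (u , v , u≢v , uv) =
  subst (IsMuK m G) (sym (floorDiv-≡0 4≤n (edgeConnectivity-missing-edge {G = G} u≢v uv λ≡l)))
        (isMuK-missing-edge {G = G} 4≤n u≢v uv)
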